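{- Let $s_1,s_2,t_1,t_2$ be $\mathcal{L}_{BT}$-terms. There exist $\mathcal{L}_{BT}$-terms $s,t$ and variables $v_1,\ldots,v_k$ such that $\mathfrak{D}\models(s_1\preceq t_1\vee s_2\preceq t_2)\leftrightarrow\exists v_1\ldots v_k[s=t]$.
   Context: Bit strings are elements of $\{\mathbf{0},\mathbf{1}\}^*$; $\varepsilon$ is the empty string. The language $\mathcal{L}_{BT}$ has constant symbols $e,0,1$, binary function symbol $\circ$, and binary relation symbol $\preceq$; terms are built from variables and $e,0,1$ with $\circ$. The structure $\mathfrak{D}$ has universe $\{\mathbf{0},\mathbf{1}\}^*$, interprets $e,0,1$ as $\varepsilon,\mathbf{0},\mathbf{1}$, $\circ$ as concatenation, and $\preceq$ as the prefix relation. A formula with free variables holds in $\mathfrak{D}$ if it holds under every assignment. -}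

module Defs where

open import Data.Nat using (ℕ)
open import Data.Bool using (Bool; true; false)
open import Data.List using (List; []; _∷_; _++_)
open import Data.List.Membership.Propositional using (_∈_)
open import Data.List.Relation.Binary.Prefix.Heterogeneous using (Prefix)
open import Data.Product using (Σ; _×_)
open import Relation.Binary.PropositionalEquality using (_≡_)
open import Relation.Nullary using (¬_)

-- Bit strings: 𝟎 is false, 𝟏 is true.
BitString : Set
BitString = List Bool

Var : Set
Var = ℕ

data Term : Set where
  var : Var → Term
  e   : Term
  c0  : Term
  c1  : Term
  _∘ₜ_ : Term → Term → Term

Assignment : Set
Assignment = Var → BitString

⟦_⟧ : Term → Assignment → BitString
⟦ var x ⟧ ρ = ρ x
⟦ e ⟧ ρ = []
⟦ c0 ⟧ ρ = false ∷ []
⟦ c1 ⟧ ρ = true ∷ []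
⟦ s ∘ₜ t ⟧ ρ = ⟦ s ⟧ ρ ++ ⟦ t ⟧ ρ

_⪯_ : BitString → BitString → Set
u ⪯ w = Prefix _≡_ u w

VariantOn : List Var → Assignment → Assignment → Set
VariantOn vs ρ σ = (x : Var) → ¬ (x ∈ vs) → σ x ≡ ρ x

SatExEq : List Var → Term → Term → Assignment → Set
SatExEq vs s t ρ = Σ Assignment (λ σ → VariantOn vs ρ σ × (⟦ s ⟧ σ ≡ ⟦ t ⟧ σ))

module Submission where

-- u ⪯ w holds iff u = c d and w = c e for some c, d, e with d empty, and a word that
-- commutes with both letters is empty.  In the equation (z₀z₁)𝟎𝟏 = 𝟎𝟏(z₀z₁), where z₀
-- is a suffix of 𝟎 and z₁ a suffix of 𝟏, only z₀z₁ = ε and z₀z₁ = 𝟎𝟏 are possible;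
-- this switch decides which of the two prefix conditions is enforced.  The resulting
-- system of equations in fresh unknowns collapses to one equation because
-- (a, b) ↦ (a𝟎b)(a𝟏b) is injective: its two halves have equal length.

open import Defs
open import Data.List using (List)
open import Data.Product using (Σ; _×_)
open import Data.Sum using (_⊎_)
open import Function.Bundles using (_⇔_)

open import Data.Bool using (false; true)
open import Data.List using ([]; _∷_; [_]; _++_; length)
open import Data.List.Properties
  using (∷-injective; ∷-injectiveˡ; ∷-injectiveʳ; ++-identityʳ; length-++)
open import Data.List.Relation.Unary.All using (All; []; _∷_)
import Data.List.Relation.Unary.All.Properties as All
open import Data.List.Membership.Propositional using (_∈_)
open import Data.List.Relation.Unary.Any using (here; there)
open import Data.List.Relation.Binary.Prefix.Propositional.Properties
  using (Prefix-as-∣ˡ; ∣ˡ-as-Prefix)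
open import Data.Nat using (ℕ; suc; pred; _+_; _⊔_; _≤_; _<_; ⌊_/2⌋)
open import Data.Nat.Properties
  using (_≟_; ≤-refl; ≤-trans; <-irrefl; m<n⇒m<1+n; m≤m⊔n; m≤n⊔m; n<1+n; n≡⌊n+n/2⌋)
open import Data.Product using (_,_; proj₁; proj₂; uncurry)
open import Data.Sum using (inj₁; inj₂)
open import Data.Vec using (Vec; []; _∷_; iterate; toList)
import Data.Vec as Vec
open import Function.Base using (_∘_)
open import Function.Bundles using (Equivalence; mk⇔)
open import Function.Construct.Composition using (_⇔-∘_)
open import Relation.Nullary using (¬_; yes; no; contradiction)
open import Relation.Binary.PropositionalEquality
  using (_≡_; _≢_; refl; sym; trans; cong; cong₂; subst; module ≡-Reasoning)

open Equivalence using (to; from)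

module _ {A : Set} where

  ++-injective : ∀ (xs ys zs ws : List A) → length xs ≡ length zs →
                 xs ++ ys ≡ zs ++ ws → xs ≡ zs × ys ≡ ws
  ++-injective []       ys []       ws _   eq = refl , eq
  ++-injective (x ∷ xs) ys (z ∷ zs) ws len eq
    with x≡z , eq′ ← ∷-injective eq
    with xs≡zs , ys≡ws ← ++-injective xs ys zs ws (cong pred len) eq′
    = cong₂ _∷_ x≡z xs≡zs , ys≡ws

  ++-halves-injective : ∀ (xs ys zs ws : List A) →
                        length xs ≡ length ys → length zs ≡ length ws →
                        xs ++ ys ≡ zs ++ ws → xs ≡ zs × ys ≡ ws
  ++-halves-injective xs ys zs ws |xs|≡|ys| |zs|≡|ws| eq =
    ++-injective xs ys zs ws |xs|≡|zs| eq
    where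
    open ≡-Reasoning
    |xs|≡|zs| : length xs ≡ length zs
    |xs|≡|zs| = begin
      length xs                          ≡⟨ n≡⌊n+n/2⌋ (length xs) ⟩
      ⌊ length xs + length xs /2⌋        ≡⟨ cong (λ n → ⌊ length xs + n /2⌋) |xs|≡|ys| ⟩
      ⌊ length xs + length ys /2⌋        ≡⟨ cong ⌊_/2⌋ (sym (length-++ xs)) ⟩
      ⌊ length (xs ++ ys) /2⌋            ≡⟨ cong (λ l → ⌊ length l /2⌋) eq ⟩
      ⌊ length (zs ++ ws) /2⌋            ≡⟨ cong ⌊_/2⌋ (length-++ zs) ⟩
      ⌊ length zs + length ws /2⌋        ≡⟨ cong (λ n → ⌊ length zs + n /2⌋) (sym |zs|≡|ws|) ⟩
      ⌊ length zs + length zs /2⌋        ≡⟨ sym (n≡⌊n+n/2⌋ (length zs)) ⟩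
      length zs                          ∎

  hole-injective : ∀ {x y : A} → x ≢ y → ∀ a b c d →
                   a ++ x ∷ b ≡ c ++ x ∷ d → a ++ y ∷ b ≡ c ++ y ∷ d → a ≡ c × b ≡ d
  hole-injective x≢y []      b []      d eqx eqy = refl , ∷-injectiveʳ eqx
  hole-injective x≢y []      b (_ ∷ c) d eqx eqy =
    contradiction (trans (∷-injectiveˡ eqx) (sym (∷-injectiveˡ eqy))) x≢y
  hole-injective x≢y (_ ∷ a) b []      d eqx eqy =
    contradiction (trans (sym (∷-injectiveˡ eqx)) (∷-injectiveˡ eqy)) x≢y
  hole-injective x≢y (_ ∷ a) b (_ ∷ c) d eqx eqy
    with a≡c , b≡d ← hole-injective x≢y a b c d (∷-injectiveʳ eqx) (∷-injectiveʳ eqy)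
    = cong₂ _∷_ (∷-injectiveˡ eqx) a≡c , b≡d

  length-hole : ∀ u v {x y : A} → length (u ++ x ∷ v) ≡ length (u ++ y ∷ v)
  length-hole u v = trans (length-++ u) (sym (length-++ u))

  double-hole-injective : ∀ {x y : A} → x ≢ y → ∀ a b c d →
                          (a ++ x ∷ b) ++ (a ++ y ∷ b) ≡ (c ++ x ∷ d) ++ (c ++ y ∷ d) →
                          a ≡ c × b ≡ d
  double-hole-injective {x} {y} x≢y a b c d eq
    with eqx , eqy ← ++-halves-injective (a ++ x ∷ b) (a ++ y ∷ b) (c ++ x ∷ d) (c ++ y ∷ d)
                       (length-hole a b) (length-hole c d) eq
    = hole-injective x≢y a b c d eqx eqy

  ++-≡-singleton : ∀ (x : A) xs ys → xs ++ ys ≡ [ x ] →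
                   (xs ≡ [] × ys ≡ [ x ]) ⊎ (xs ≡ [ x ] × ys ≡ [])
  ++-≡-singleton x []          ys      eq = inj₁ (refl , eq)
  ++-≡-singleton x (_ ∷ [])    []      eq = inj₂ (eq , refl)
  ++-≡-singleton x (_ ∷ [])    (_ ∷ _) eq with () ← ∷-injectiveʳ eq
  ++-≡-singleton x (_ ∷ _ ∷ _) ys      eq with () ← ∷-injectiveʳ eq

  commutes-with-distinct-letters⇒[] : ∀ {x y : A} → x ≢ y → ∀ d →
    d ++ [ x ] ≡ x ∷ d → d ++ [ y ] ≡ y ∷ d → d ≡ []
  commutes-with-distinct-letters⇒[] x≢y []      _   _   = refl
  commutes-with-distinct-letters⇒[] x≢y (_ ∷ d) eqx eqy =
    contradiction (trans (sym (∷-injectiveˡ eqx)) (∷-injectiveˡ eqy)) x≢y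

⪯-++ : ∀ u v → u ⪯ (u ++ v)
⪯-++ u v = ∣ˡ-as-Prefix record { quotient = v ; equality = refl }

Equation : Set
Equation = Term × Term

_⊨_ : Assignment → Equation → Set
σ ⊨ (s , t) = ⟦ s ⟧ σ ≡ ⟦ t ⟧ σ

_∧ₑ_ : Equation → Equation → Equation
(s₁ , t₁) ∧ₑ (s₂ , t₂) =
  (s₁ ∘ₜ (c0 ∘ₜ s₂)) ∘ₜ (s₁ ∘ₜ (c1 ∘ₜ s₂)) , (t₁ ∘ₜ (c0 ∘ₜ t₂)) ∘ₜ (t₁ ∘ₜ (c1 ∘ₜ t₂))

⊨-∧ₑ : ∀ σ p q → σ ⊨ (p ∧ₑ q) ⇔ (σ ⊨ p × σ ⊨ q)
⊨-∧ₑ σ (s₁ , t₁) (s₂ , t₂) = mk⇔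
  (double-hole-injective (λ ()) (⟦ s₁ ⟧ σ) (⟦ s₂ ⟧ σ) (⟦ t₁ ⟧ σ) (⟦ t₂ ⟧ σ))
  (uncurry (cong₂ λ a b → (a ++ false ∷ b) ++ (a ++ true ∷ b)))

⋀ : List Equation → Equation
⋀ []       = e , e
⋀ (q ∷ qs) = q ∧ₑ ⋀ qs

⊨-⋀ : ∀ σ qs → σ ⊨ ⋀ qs ⇔ All (σ ⊨_) qs
⊨-⋀ σ []       = mk⇔ (λ _ → []) (λ _ → refl)
⊨-⋀ σ (q ∷ qs) = mk⇔
  (λ h → let σ⊨q , σ⊨⋀qs = to (⊨-∧ₑ σ q (⋀ qs)) h in σ⊨q ∷ to (⊨-⋀ σ qs) σ⊨⋀qs)
  (λ { (σ⊨q ∷ σ⊨qs) → from (⊨-∧ₑ σ q (⋀ qs)) (σ⊨q , from (⊨-⋀ σ qs) σ⊨qs) })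

varBound : Term → ℕ
varBound (var x)  = suc x
varBound e        = 0
varBound c0       = 0
varBound c1       = 0
varBound (s ∘ₜ t) = varBound s ⊔ varBound t

varBound-∘ˡ : ∀ s t {N} → varBound (s ∘ₜ t) ≤ N → varBound s ≤ N
varBound-∘ˡ s t = ≤-trans (m≤m⊔n (varBound s) (varBound t))

varBound-∘ʳ : ∀ s t {N} → varBound (s ∘ₜ t) ≤ N → varBound t ≤ N
varBound-∘ʳ s t = ≤-trans (m≤n⊔m (varBound s) (varBound t))

⟦⟧-cong : ∀ t {N σ ρ} → varBound t ≤ N → (∀ x → x < N → σ x ≡ ρ x) → ⟦ t ⟧ σ ≡ ⟦ t ⟧ ρ
⟦⟧-cong (var x)  x<N σ≡ρ = σ≡ρ x x<N
⟦⟧-cong e        _   _   = refl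
⟦⟧-cong c0       _   _   = refl
⟦⟧-cong c1       _   _   = refl
⟦⟧-cong (s ∘ₜ t) bnd σ≡ρ =
  cong₂ _++_ (⟦⟧-cong s (varBound-∘ˡ s t bnd) σ≡ρ) (⟦⟧-cong t (varBound-∘ʳ s t bnd) σ≡ρ)

_[_↦_] : Assignment → Var → BitString → Assignment
(ρ [ x ↦ w ]) y with y ≟ x
... | yes _ = w
... | no  _ = ρ y

[↦]-same : ∀ ρ x w → (ρ [ x ↦ w ]) x ≡ w
[↦]-same ρ x w with x ≟ x
... | yes _   = refl
... | no  x≢x = contradiction refl x≢x

[↦]-other : ∀ ρ {x y} w → y ≢ x → (ρ [ x ↦ w ]) y ≡ ρ y
[↦]-other ρ {x} {y} w y≢x with y ≟ x
... | yes y≡x = contradiction y≡x y≢x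
... | no  _   = refl

_[_↦*_] : ∀ {n} → Assignment → Var → Vec BitString n → Assignment
ρ [ x ↦* [] ]     = ρ
ρ [ x ↦* w ∷ ws ] = (ρ [ x ↦ w ]) [ suc x ↦* ws ]

<⇒∉-iterate-suc : ∀ {x y n} → y < x → ¬ y ∈ toList (iterate suc x n)
<⇒∉-iterate-suc {n = suc n} y<x (here refl) = <-irrefl refl y<x
<⇒∉-iterate-suc {n = suc n} y<x (there y∈) = <⇒∉-iterate-suc (m<n⇒m<1+n y<x) y∈

[↦*]-variant : ∀ ρ x {n} (ws : Vec BitString n) →
               VariantOn (toList (iterate suc x n)) ρ (ρ [ x ↦* ws ])
[↦*]-variant ρ x []       y _  = refl
[↦*]-variant ρ x (w ∷ ws) y y∉ = begin
  ((ρ [ x ↦ w ]) [ suc x ↦* ws ]) y ≡⟨ [↦*]-variant (ρ [ x ↦ w ]) (suc x) ws y (y∉ ∘ there) ⟩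
  (ρ [ x ↦ w ]) y                   ≡⟨ [↦]-other ρ w (y∉ ∘ here) ⟩
  ρ y                               ∎
  where open ≡-Reasoning

[↦*]-iterate : ∀ ρ x {n} (ws : Vec BitString n) → Vec.map (ρ [ x ↦* ws ]) (iterate suc x n) ≡ ws
[↦*]-iterate ρ x []       = refl
[↦*]-iterate ρ x (w ∷ ws) = cong₂ _∷_ x↦w ([↦*]-iterate (ρ [ x ↦ w ]) (suc x) ws)
  where
  x↦w : ((ρ [ x ↦ w ]) [ suc x ↦* ws ]) x ≡ w
  x↦w = trans ([↦*]-variant (ρ [ x ↦ w ]) (suc x) ws x (<⇒∉-iterate-suc (n<1+n x))) ([↦]-same ρ x w)

variant⇒agree-below : ∀ {N n ρ σ} → VariantOn (toList (iterate suc N n)) ρ σ →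
                      ∀ x → x < N → σ x ≡ ρ x
variant⇒agree-below variant x x<N = variant x (<⇒∉-iterate-suc x<N)

-- uᵢ = cᵢ dᵢ and wᵢ = cᵢ eᵢ; the switch forces z₀ z₁ = 𝟎𝟏 or y₀ y₁ = 𝟎𝟏, and
-- correspondingly d₁ or d₂ has to commute with both letters.
prefixOrSystem : {A : Set} → (A → A → A) → (𝟎 𝟏 : A) →
                 Vec A 10 → (u₁ w₁ u₂ w₂ : A) → List (A × A)
prefixOrSystem _·_ 𝟎 𝟏 (c₁ ∷ d₁ ∷ e₁ ∷ c₂ ∷ d₂ ∷ e₂ ∷ y₀ ∷ z₀ ∷ y₁ ∷ z₁ ∷ []) u₁ w₁ u₂ w₂ =
  (c₁ · d₁ , u₁) ∷ (c₁ · e₁ , w₁) ∷ (c₂ · d₂ , u₂) ∷ (c₂ · e₂ , w₂) ∷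
  (y₀ · z₀ , 𝟎) ∷ (y₁ · z₁ , 𝟏) ∷ ((z₀ · z₁) · (𝟎 · 𝟏) , (𝟎 · 𝟏) · (z₀ · z₁)) ∷
  (d₁ · z₀ , z₀ · d₁) ∷ (d₁ · z₁ , z₁ · d₁) ∷ (d₂ · y₀ , y₀ · d₂) ∷ (d₂ · y₁ , y₁ · d₂) ∷ []

Solves : Vec BitString 10 → (u₁ w₁ u₂ w₂ : BitString) → Set
Solves ws u₁ w₁ u₂ w₂ = All (uncurry _≡_) (prefixOrSystem _++_ [ false ] [ true ] ws u₁ w₁ u₂ w₂)

Solves-cong : ∀ {ws ws′ u₁ u₁′ w₁ w₁′ u₂ u₂′ w₂ w₂′} →
              ws ≡ ws′ → u₁ ≡ u₁′ → w₁ ≡ w₁′ → u₂ ≡ u₂′ → w₂ ≡ w₂′ →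
              Solves ws u₁ w₁ u₂ w₂ → Solves ws′ u₁′ w₁′ u₂′ w₂′
Solves-cong refl refl refl refl refl sol = sol

switch-cases : ∀ y₀ z₀ y₁ z₁ → y₀ ++ z₀ ≡ [ false ] → y₁ ++ z₁ ≡ [ true ] →
               (z₀ ++ z₁) ++ false ∷ true ∷ [] ≡ false ∷ true ∷ z₀ ++ z₁ →
               (z₀ ≡ [ false ] × z₁ ≡ [ true ]) ⊎ (y₀ ≡ [ false ] × y₁ ≡ [ true ])
switch-cases y₀ z₀ y₁ z₁ y₀z₀ y₁z₁ comm
  with ++-≡-singleton false y₀ z₀ y₀z₀ | ++-≡-singleton true y₁ z₁ y₁z₁
... | inj₁ (_ , refl)    | inj₁ (_ , refl)    = inj₁ (refl , refl)
... | inj₂ (refl , refl) | inj₂ (refl , refl) = inj₂ (refl , refl)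
... | inj₁ (_ , refl)    | inj₂ (_ , refl)    with () ← comm
... | inj₂ (_ , refl)    | inj₁ (_ , refl)    with () ← comm

common-prefix : ∀ c {d} v → d ≡ [] → (c ++ d) ⪯ (c ++ v)
common-prefix c v refl = subst (_⪯ (c ++ v)) (sym (++-identityʳ c)) (⪯-++ c v)

solves⇒prefix : ∀ ws {u₁ w₁ u₂ w₂} → Solves ws u₁ w₁ u₂ w₂ → (u₁ ⪯ w₁) ⊎ (u₂ ⪯ w₂)
solves⇒prefix (c₁ ∷ d₁ ∷ e₁ ∷ c₂ ∷ d₂ ∷ e₂ ∷ y₀ ∷ z₀ ∷ y₁ ∷ z₁ ∷ [])
  (refl ∷ refl ∷ refl ∷ refl ∷ y₀z₀ ∷ y₁z₁ ∷ comm ∷ d₁z₀ ∷ d₁z₁ ∷ d₂y₀ ∷ d₂y₁ ∷ [])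
  with switch-cases y₀ z₀ y₁ z₁ y₀z₀ y₁z₁ comm
... | inj₁ (refl , refl) =
  inj₁ (common-prefix c₁ e₁ (commutes-with-distinct-letters⇒[] (λ ()) d₁ d₁z₀ d₁z₁))
... | inj₂ (refl , refl) =
  inj₂ (common-prefix c₂ e₂ (commutes-with-distinct-letters⇒[] (λ ()) d₂ d₂y₀ d₂y₁))

prefix⇒solves : ∀ {u₁ w₁ u₂ w₂} → (u₁ ⪯ w₁) ⊎ (u₂ ⪯ w₂) →
                Σ (Vec BitString 10) λ ws → Solves ws u₁ w₁ u₂ w₂
prefix⇒solves {u₁} {_} {u₂} {w₂} (inj₁ u₁⪯w₁)
  with record { quotient = e₁ ; equality = refl } ← Prefix-as-∣ˡ u₁⪯w₁ =
  (u₁ ∷ [] ∷ e₁ ∷ [] ∷ u₂ ∷ w₂ ∷ [] ∷ [ false ] ∷ [] ∷ [ true ] ∷ []) ,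
  ++-identityʳ u₁ ∷ refl ∷ refl ∷ refl ∷ refl ∷ refl ∷ refl ∷
  refl ∷ refl ∷ ++-identityʳ u₂ ∷ ++-identityʳ u₂ ∷ []
prefix⇒solves {u₁} {w₁} {u₂} (inj₂ u₂⪯w₂)
  with record { quotient = e₂ ; equality = refl } ← Prefix-as-∣ˡ u₂⪯w₂ =
  ([] ∷ u₁ ∷ w₁ ∷ u₂ ∷ [] ∷ e₂ ∷ [ false ] ∷ [] ∷ [ true ] ∷ [] ∷ []) ,
  refl ∷ refl ∷ ++-identityʳ u₂ ∷ refl ∷ refl ∷ refl ∷ refl ∷
  ++-identityʳ u₁ ∷ ++-identityʳ u₁ ∷ refl ∷ refl ∷ []

⊨-prefixOrSystem : ∀ σ (xs : Vec Var 10) s₁ t₁ s₂ t₂ →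
  All (σ ⊨_) (prefixOrSystem _∘ₜ_ c0 c1 (Vec.map var xs) s₁ t₁ s₂ t₂) ⇔
  Solves (Vec.map σ xs) (⟦ s₁ ⟧ σ) (⟦ t₁ ⟧ σ) (⟦ s₂ ⟧ σ) (⟦ t₂ ⟧ σ)
⊨-prefixOrSystem σ (_ ∷ _ ∷ _ ∷ _ ∷ _ ∷ _ ∷ _ ∷ _ ∷ _ ∷ _ ∷ []) s₁ t₁ s₂ t₂ =
  mk⇔ All.map⁺ All.map⁻

Solves-⟦⟧-cong : ∀ {N ρ σ} s₁ t₁ s₂ t₂ → varBound ((s₁ ∘ₜ t₁) ∘ₜ (s₂ ∘ₜ t₂)) ≤ N →
  (∀ x → x < N → σ x ≡ ρ x) → ∀ ws →
  Solves ws (⟦ s₁ ⟧ σ) (⟦ t₁ ⟧ σ) (⟦ s₂ ⟧ σ) (⟦ t₂ ⟧ σ) ⇔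
  Solves ws (⟦ s₁ ⟧ ρ) (⟦ t₁ ⟧ ρ) (⟦ s₂ ⟧ ρ) (⟦ t₂ ⟧ ρ)
Solves-⟦⟧-cong {N} {ρ} {σ} s₁ t₁ s₂ t₂ bound agree ws =
  mk⇔ (Solves-cong {ws = ws} refl eq₁ eq₂ eq₃ eq₄)
      (Solves-cong {ws = ws} refl (sym eq₁) (sym eq₂) (sym eq₃) (sym eq₄))
  where
  bound₁ : varBound (s₁ ∘ₜ t₁) ≤ N
  bound₁ = varBound-∘ˡ (s₁ ∘ₜ t₁) (s₂ ∘ₜ t₂) bound
  bound₂ : varBound (s₂ ∘ₜ t₂) ≤ N
  bound₂ = varBound-∘ʳ (s₁ ∘ₜ t₁) (s₂ ∘ₜ t₂) bound
  eq₁ : ⟦ s₁ ⟧ σ ≡ ⟦ s₁ ⟧ ρ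
  eq₁ = ⟦⟧-cong s₁ (varBound-∘ˡ s₁ t₁ bound₁) agree
  eq₂ : ⟦ t₁ ⟧ σ ≡ ⟦ t₁ ⟧ ρ
  eq₂ = ⟦⟧-cong t₁ (varBound-∘ʳ s₁ t₁ bound₁) agree
  eq₃ : ⟦ s₂ ⟧ σ ≡ ⟦ s₂ ⟧ ρ
  eq₃ = ⟦⟧-cong s₂ (varBound-∘ˡ s₂ t₂ bound₂) agree
  eq₄ : ⟦ t₂ ⟧ σ ≡ ⟦ t₂ ⟧ ρ
  eq₄ = ⟦⟧-cong t₂ (varBound-∘ʳ s₂ t₂ bound₂) agree

freshPrefixOrSystem : ℕ → (s₁ t₁ s₂ t₂ : Term) → List Equation
freshPrefixOrSystem N = prefixOrSystem _∘ₜ_ c0 c1 (Vec.map var (iterate suc N 10))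

⊨-freshPrefixOrSystem : ∀ {N ρ σ} s₁ t₁ s₂ t₂ → varBound ((s₁ ∘ₜ t₁) ∘ₜ (s₂ ∘ₜ t₂)) ≤ N →
  VariantOn (toList (iterate suc N 10)) ρ σ →
  σ ⊨ ⋀ (freshPrefixOrSystem N s₁ t₁ s₂ t₂) ⇔
  Solves (Vec.map σ (iterate suc N 10)) (⟦ s₁ ⟧ ρ) (⟦ t₁ ⟧ ρ) (⟦ s₂ ⟧ ρ) (⟦ t₂ ⟧ ρ)
⊨-freshPrefixOrSystem {N} {σ = σ} s₁ t₁ s₂ t₂ bound variant =
  Solves-⟦⟧-cong s₁ t₁ s₂ t₂ bound (variant⇒agree-below variant) (Vec.map σ (iterate suc N 10))
    ⇔-∘ (⊨-prefixOrSystem σ (iterate suc N 10) s₁ t₁ s₂ t₂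
    ⇔-∘ ⊨-⋀ σ (freshPrefixOrSystem N s₁ t₁ s₂ t₂))

lemma16 : (s₁ s₂ t₁ t₂ : Term) →
    Σ Term (λ s → Σ Term (λ t → Σ (List Var) (λ vs →
      (ρ : Assignment) →
        ((⟦ s₁ ⟧ ρ ⪯ ⟦ t₁ ⟧ ρ) ⊎ (⟦ s₂ ⟧ ρ ⪯ ⟦ t₂ ⟧ ρ)) ⇔ SatExEq vs s t ρ)))
lemma16 s₁ s₂ t₁ t₂ =
  proj₁ equation , proj₂ equation , toList unknowns , λ ρ → mk⇔ (introduce ρ) (eliminate ρ)
  where
  N : ℕ
  N = varBound ((s₁ ∘ₜ t₁) ∘ₜ (s₂ ∘ₜ t₂))

  unknowns : Vec Var 10
  unknowns = iterate suc N 10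

  equation : Equation
  equation = ⋀ (freshPrefixOrSystem N s₁ t₁ s₂ t₂)

  introduce : ∀ ρ → (⟦ s₁ ⟧ ρ ⪯ ⟦ t₁ ⟧ ρ) ⊎ (⟦ s₂ ⟧ ρ ⪯ ⟦ t₂ ⟧ ρ) →
              SatExEq (toList unknowns) (proj₁ equation) (proj₂ equation) ρ
  introduce ρ prefix with ws , sol ← prefix⇒solves prefix =
    ρ [ N ↦* ws ] , variant ,
    from (⊨-freshPrefixOrSystem s₁ t₁ s₂ t₂ ≤-refl variant)
      (Solves-cong (sym ([↦*]-iterate ρ N ws)) refl refl refl refl sol)
    where
    variant : VariantOn (toList unknowns) ρ (ρ [ N ↦* ws ])
    variant = [↦*]-variant ρ N ws

  eliminate : ∀ ρ → SatExEq (toList unknowns) (proj₁ equation) (proj₂ equation) ρ →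
              (⟦ s₁ ⟧ ρ ⪯ ⟦ t₁ ⟧ ρ) ⊎ (⟦ s₂ ⟧ ρ ⪯ ⟦ t₂ ⟧ ρ)
  eliminate ρ (σ , variant , σ⊨equation) =
    solves⇒prefix (Vec.map σ unknowns)
      (to (⊨-freshPrefixOrSystem s₁ t₁ s₂ t₂ ≤-refl variant) σ⊨equation)
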